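{- The set $\{\overleftrightarrow{K_2}, \overrightarrow{K_2}\}$ is the unique heroic set of size two, i.e. it is the only set $\mathcal F$ of exactly two digraphs such that $Forb_{ind}(\mathcal F)$ has bounded dichromatic number.
   Context: Digraphs have no loops and no parallel arcs, but both $xy$ and $yx$ may be arcs. An acyclic coloring (dicoloring) of a digraph $D$ is a coloring of its vertices such that no color class induces a directed cycle; the dichromatic number $\vec\chi(D)$ is the minimum number of colors in such a coloring. For a class $\mathcal C$, $\vec\chi(\mathcal C)=\sup\{\vec\chi(D): D\in\mathcal C\}$. For a set $\mathcal F$ of digraphs, $Forb_{ind}(\mathcal F)$ is the class of digraphs containing no member of $\mathcal F$ as an induced subdigraph. A set $\mathcal F$ is heroic if $Forb_{ind}(\mathcal F)$ has bounded dichromatic number. $\overleftrightarrow{K_2}$ is the digraph on two vertices $x,y$ with both arcs $xy$ and $yx$ (a digon); $\overrightarrow{K_2}$ is the digraph on two vertices with exactly one arc. -}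

module Defs where

open import Data.Nat using (ℕ; zero; suc; _≤_)
open import Data.Fin using (Fin; zero; suc; inject₁; fromℕ)
open import Data.Bool using (Bool; true; false)
open import Data.Product using (Σ; ∃; _×_; _,_)
open import Relation.Binary.PropositionalEquality using (_≡_)
open import Relation.Nullary using (¬_)
open import Function.Definitions using (Injective; Bijective)

-- A (finite) digraph on vertex set Fin size; arc u v = true means uv is an arc.
-- No loops; no parallel arcs (automatic); both uv and vu may be arcs.
record Digraph : Set where
  field
    size     : ℕ
    arc      : Fin size → Fin size → Bool
    loopless : ∀ v → arc v v ≡ false
open Digraph public

_⊑ᵢ_ : Digraph → Digraph → Set
H ⊑ᵢ G = Σ (Fin (size H) → Fin (size G)) λ f →
  Injective _≡_ _≡_ f × (∀ i j → arc H i j ≡ arc G (f i) (f j))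

_≅_ : Digraph → Digraph → Set
H ≅ G = Σ (Fin (size H) → Fin (size G)) λ f →
  Bijective _≡_ _≡_ f × (∀ i j → arc H i j ≡ arc G (f i) (f j))

-- A directed cycle of length suc l (l ≥ 1) in D all of whose vertices satisfy P:
-- distinct vertices c 0, …, c l with arcs c i → c (i+1) and c l → c 0.
record DirCycleIn (D : Digraph) (P : Fin (size D) → Set) : Set where
  field
    len    : ℕ
    len≥1  : 1 ≤ len
    vert   : Fin (suc len) → Fin (size D)
    inj    : Injective _≡_ _≡_ vert
    step   : ∀ (i : Fin len) → arc D (vert (inject₁ i)) (vert (suc i)) ≡ true
    close  : arc D (vert (fromℕ len)) (vert zero) ≡ true
    inside : ∀ i → P (vert i)

IsDicoloring : (D : Digraph) (k : ℕ) → (Fin (size D) → Fin k) → Set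
IsDicoloring D k col = ∀ (a : Fin k) → ¬ DirCycleIn D (λ v → col v ≡ a)

DichromaticAtMost : Digraph → ℕ → Set
DichromaticAtMost D k = Σ (Fin (size D) → Fin k) (IsDicoloring D k)

ForbInd₂ : Digraph → Digraph → Digraph → Set
ForbInd₂ F₁ F₂ D = ¬ (F₁ ⊑ᵢ D) × ¬ (F₂ ⊑ᵢ D)

Heroic₂ : Digraph → Digraph → Set
Heroic₂ F₁ F₂ = ∃ λ (k : ℕ) → ∀ (D : Digraph) → ForbInd₂ F₁ F₂ D → DichromaticAtMost D k

digonArc : Fin 2 → Fin 2 → Bool
digonArc zero zero = false
digonArc zero (suc zero) = true
digonArc (suc zero) zero = true
digonArc (suc zero) (suc zero) = false

digonLoopless : ∀ v → digonArc v v ≡ false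
digonLoopless zero = _≡_.refl
digonLoopless (suc zero) = _≡_.refl

digon : Digraph
digon = record { size = 2 ; arc = digonArc ; loopless = digonLoopless }

oneArc : Fin 2 → Fin 2 → Bool
oneArc zero zero = false
oneArc zero (suc zero) = true
oneArc (suc zero) zero = false
oneArc (suc zero) (suc zero) = false

oneArcLoopless : ∀ v → oneArc v v ≡ false
oneArcLoopless zero = _≡_.refl
oneArcLoopless (suc zero) = _≡_.refl

arcK₂ : Digraph
arcK₂ = record { size = 2 ; arc = oneArc ; loopless = oneArcLoopless }

-- If D contains neither a digon nor a single arc as an induced subdigraph then D has
-- no arcs at all, so one colour suffices. Conversely, if Forb_ind(F₁, F₂) has dichromatic number
-- at most k, then every hereditary class of unbounded dichromatic number contains F₁ or F₂, since
-- otherwise the whole class would lie in Forb_ind(F₁, F₂). Four such classes are used: complete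
-- symmetric digraphs, tournaments, and triangle-free oriented and triangle-free symmetric
-- digraphs. Say F₁ is complete symmetric; it contains a digon, so F₂ is a triangle-free
-- tournament, hence not symmetric, so F₁ is triangle-free too; with at least two vertices each,
-- F₁ is a digon and F₂ a single arc.
-- Tournaments of large dichromatic number are built recursively from a vertex x and two copies
-- A, B of the previous one, with arcs x → A → B → x. Triangle-free oriented ones come from a
-- directed Tutte-type construction: N independent anchors, and for each frame (two disjoint
-- injective tuples of anchors) a copy of the previous digraph whose d-th vertex has an arc from
-- the d-th anchor of the first tuple and one to the d-th anchor of the second. Given a colouring,
-- a large colour class of anchors, say of colour c, carries the acyclic relation "joined by a path
-- through a c-coloured copy vertex"; a frame whose first tuple consists of successive sinks of this
-- relation has a copy avoiding c, so the copy needs all the other colours. Symmetrising these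
-- digraphs gives the symmetric family.

module Submission where

open import Defs
open import Data.Nat using (ℕ; zero; suc; _≤_; _<_; _+_; _*_; _^_; z≤n; s≤s)
import Data.Nat as ℕ
open import Data.Nat.Properties
  using (≤-refl; ≤-antisym; <-trans; ≤-pred; <⇒≤; ≰⇒>; <⇒≱; ≮⇒≥; ≤∧≢⇒<; n≮0; n<1+n;
         +-suc; +-comm; +-mono-≤)
open import Data.Fin using (Fin; zero; suc; toℕ; fromℕ; fromℕ<; inject₁; inject≤; punchIn; punchOut)
open import Data.Fin.Properties
  using (_≟_; all?; pigeonhole; <⇒≢; toℕ-injective; toℕ<n; fromℕ<-injective; inject≤-injective;
         punchIn-punchOut; +↔⊎; *↔×; 1↔⊤)
open import Data.Fin.Permutation using (transpose)
open import Data.Bool using (Bool; true; false; not; _∨_)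
import Data.Bool.Properties as Bool
open import Data.Product using (Σ; ∃; ∃₂; _×_; _,_; proj₁; proj₂; uncurry)
import Data.Product as Product
open import Data.Product.Properties using () renaming (≡-dec to ×-≡-dec)
open import Data.Product.Function.NonDependent.Propositional using (_×-↔_)
open import Data.Sum using (_⊎_; inj₁; inj₂; fromInj₂)
import Data.Sum as Sum
open import Data.Sum.Function.Propositional using (_⊎-↔_)
open import Data.Unit using (⊤; tt)
open import Data.Empty using (⊥; ⊥-elim)
open import Data.Vec using (Vec; []; _∷_; lookup; tabulate; uncons)
import Data.Vec.Properties as Vec
open import Data.List using (List; []; _∷_; _∷ʳ_; length; map; filter; allFin)
import Data.List as List
open import Data.List.Properties using (length-++; length-tabulate; filter-reject; filter-all)
open import Data.List.Relation.Unary.All using (All; []; _∷_)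
import Data.List.Relation.Unary.All as All
import Data.List.Relation.Unary.All.Properties as All
open import Data.List.Relation.Unary.Any using (here; there)
open import Data.List.Relation.Unary.Linked using (Linked; []; [-]; _∷_)
import Data.List.Relation.Unary.Linked as Linked
import Data.List.Relation.Unary.Linked.Properties as Linked
open import Data.List.Relation.Unary.AllPairs using ([]; _∷_)
open import Data.List.Relation.Unary.Unique.Propositional using (Unique)
import Data.List.Relation.Unary.Unique.Propositional.Properties as Unique
open import Data.List.Membership.Propositional using (_∈_; _∉_)
open import Data.List.Membership.Propositional.Properties using (∈-lookup; ∈-filter⁻)
open import Function using (_∘_; case_of_)
open import Function.Bundles using (_⇔_; mk⇔; _↔_; mk↔ₛ′; Inverse; Bijection)
open import Function.Definitions using (Injective)
open import Function.Properties.Inverse using (↔-refl; ↔-trans; Inverse⇒Bijection)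
open import Relation.Binary.PropositionalEquality using (_≡_; _≢_; refl; sym; trans; cong; cong₂; subst)
open import Relation.Binary.Definitions using () renaming (Decidable to Decidable₂)
open import Relation.Nullary using (¬_; Dec; yes; no; does; contradiction)
open import Relation.Nullary.Decidable
  using (_×-dec_; _⊎-dec_; _→-dec_; ¬?; dec-true; dec-false; ¬¬-excluded-middle)
open import Relation.Unary using (Decidable; _∩_)
open import Relation.Unary.Properties using (_∩?_; ∁?)

Adjacent : (D : Digraph) → Fin (size D) → Fin (size D) → Set
Adjacent D i j = arc D i j ≡ true ⊎ arc D j i ≡ true

Complete Tournament Oriented Symmetric TriangleFree : Digraph → Set
Complete D = ∀ i j → i ≢ j → arc D i j ≡ true
Tournament D = ∀ i j → i ≢ j → arc D j i ≡ not (arc D i j)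
Oriented D = ∀ i j → arc D i j ≡ true → arc D j i ≡ false
Symmetric D = ∀ i j → arc D i j ≡ arc D j i
TriangleFree D = ∀ i j k → ¬ (Adjacent D i j × Adjacent D j k × Adjacent D i k)

OrientedTriangleFree SymmetricTriangleFree : Digraph → Set
OrientedTriangleFree = Oriented ∩ TriangleFree
SymmetricTriangleFree = Symmetric ∩ TriangleFree

Hereditary : (Digraph → Set) → Set
Hereditary 𝒞 = ∀ H G → H ⊑ᵢ G → 𝒞 G → 𝒞 H

module _ (H G : Digraph) (H⊑G : H ⊑ᵢ G) where

  private
    f : Fin (size H) → Fin (size G)
    f = proj₁ H⊑G
    f-inj : Injective _≡_ _≡_ f
    f-inj = proj₁ (proj₂ H⊑G)
    f-arc : ∀ i j → arc H i j ≡ arc G (f i) (f j)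
    f-arc = proj₂ (proj₂ H⊑G)
    adjacent : ∀ {i j} → Adjacent H i j → Adjacent G (f i) (f j)
    adjacent {i} {j} = Sum.map (trans (sym (f-arc i j))) (trans (sym (f-arc j i)))

  ⊑-complete : Complete G → Complete H
  ⊑-complete c i j i≢j = trans (f-arc i j) (c (f i) (f j) (i≢j ∘ f-inj))

  ⊑-tournament : Tournament G → Tournament H
  ⊑-tournament t i j i≢j rewrite f-arc i j | f-arc j i = t (f i) (f j) (i≢j ∘ f-inj)

  ⊑-oriented : Oriented G → Oriented H
  ⊑-oriented o i j a rewrite f-arc j i = o (f i) (f j) (trans (sym (f-arc i j)) a)

  ⊑-symmetric : Symmetric G → Symmetric H
  ⊑-symmetric s i j rewrite f-arc i j | f-arc j i = s (f i) (f j)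

  ⊑-triangleFree : TriangleFree G → TriangleFree H
  ⊑-triangleFree t i j k (a , b , c) = t (f i) (f j) (f k) (adjacent a , adjacent b , adjacent c)

Complete? : ∀ D → Dec (Complete D)
Complete? D = all? λ i → all? λ j → ¬? (i ≟ j) →-dec arc D i j Bool.≟ true

Tournament? : ∀ D → Dec (Tournament D)
Tournament? D = all? λ i → all? λ j → ¬? (i ≟ j) →-dec arc D j i Bool.≟ not (arc D i j)

Oriented? : ∀ D → Dec (Oriented D)
Oriented? D = all? λ i → all? λ j → (arc D i j Bool.≟ true) →-dec (arc D j i Bool.≟ false)

Symmetric? : ∀ D → Dec (Symmetric D)
Symmetric? D = all? λ i → all? λ j → arc D i j Bool.≟ arc D j i

TriangleFree? : ∀ D → Dec (TriangleFree D)
TriangleFree? D = all? λ i → all? λ j → all? λ k →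
  ¬? (adjacent? i j ×-dec adjacent? j k ×-dec adjacent? i k)
  where
  adjacent? : ∀ i j → Dec (Adjacent D i j)
  adjacent? i j = (arc D i j Bool.≟ true) ⊎-dec (arc D j i Bool.≟ true)

∩-hereditary : ∀ {𝒞 𝒟} → Hereditary 𝒞 → Hereditary 𝒟 → Hereditary (𝒞 ∩ 𝒟)
∩-hereditary h₁ h₂ H G e = Product.map (h₁ H G e) (h₂ H G e)

Unbounded : (Digraph → Set) → Set
Unbounded 𝒞 = ∀ k → ∃ λ D → 𝒞 D × ¬ DichromaticAtMost D k

heroic-meets : ∀ {𝒞 : Digraph → Set} F₁ F₂ → Heroic₂ F₁ F₂ →
               Hereditary 𝒞 → Unbounded 𝒞 → Decidable 𝒞 → 𝒞 F₁ ⊎ 𝒞 F₂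
heroic-meets F₁ F₂ (k , bound) hered unbounded 𝒞? with 𝒞? F₁ | 𝒞? F₂
... | yes p | _ = inj₁ p
... | no _ | yes q = inj₂ q
... | no ¬p | no ¬q with unbounded k
... | D , D∈𝒞 , D-big =
  ⊥-elim (D-big (bound D ((λ e → ¬p (hered F₁ D e D∈𝒞)) , (λ e → ¬q (hered F₂ D e D∈𝒞)))))

heroic-swap : ∀ F₁ F₂ → Heroic₂ F₁ F₂ → Heroic₂ F₂ F₁
heroic-swap F₁ F₂ (k , bound) = k , λ D → bound D ∘ Product.swap

-- Digraphs on two vertices

Semicomplete : Digraph → Set
Semicomplete D = ∀ i j → i ≢ j → Adjacent D i j

complete⇒semicomplete : ∀ {D} → Complete D → Semicomplete D
complete⇒semicomplete c i j i≢j = inj₁ (c i j i≢j)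

tournament⇒semicomplete : ∀ {D} → Tournament D → Semicomplete D
tournament⇒semicomplete {D} t i j i≢j with arc D i j in eq
... | true = inj₁ refl
... | false = inj₂ (trans (t i j i≢j) (cong not eq))

fromℕ<-≢ : ∀ {n} m₁ m₂ (p : m₁ < n) (q : m₂ < n) → m₁ ≢ m₂ → fromℕ< p ≢ fromℕ< q
fromℕ<-≢ m₁ m₂ p q m₁≢m₂ = m₁≢m₂ ∘ fromℕ<-injective m₁ m₂ p q

two-vertices : ∀ D → 2 ≤ size D → ∃₂ λ (i j : Fin (size D)) → i ≢ j
two-vertices D 2≤ = _ , _ , fromℕ<-≢ 0 1 (<-trans (s≤s z≤n) 2≤) 2≤ (λ ())

semicomplete-triangleFree⇒size≡2 : ∀ D → 2 ≤ size D → Semicomplete D → TriangleFree D → size D ≡ 2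
semicomplete-triangleFree⇒size≡2 D 2≤ sc tf with size D ℕ.≤? 2
... | yes ≤2 = ≤-antisym ≤2 2≤
... | no ≰2 = ⊥-elim (tf a b c (sc a b (fromℕ<-≢ 0 1 p q (λ ())) ,
                                sc b c (fromℕ<-≢ 1 2 q r (λ ())) ,
                                sc a c (fromℕ<-≢ 0 2 p r (λ ()))))
  where
  r : 2 < size D
  r = ≰⇒> ≰2
  q : 1 < size D
  q = <-trans (s≤s (s≤s z≤n)) r
  p : 0 < size D
  p = <-trans (s≤s z≤n) q
  a b c : Fin (size D)
  a = fromℕ< p
  b = fromℕ< q
  c = fromℕ< r

module _ (D : Digraph) (2≤ : 2 ≤ size D) where

  complete⇒¬tournament : Complete D → ¬ Tournament D
  complete⇒¬tournament c t with i , j , i≢j ← two-vertices D 2≤ =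
    Bool.not-¬ (trans (c j i (i≢j ∘ sym)) (sym (c i j i≢j))) (t i j i≢j)

  complete⇒¬oriented : Complete D → ¬ Oriented D
  complete⇒¬oriented c o with i , j , i≢j ← two-vertices D 2≤ =
    Bool.not-¬ (c j i (i≢j ∘ sym)) (o i j (c i j i≢j))

  tournament⇒¬symmetric : Tournament D → ¬ Symmetric D
  tournament⇒¬symmetric t sym′ with i , j , i≢j ← two-vertices D 2≤ =
    Bool.not-¬ (sym′ j i) (t i j i≢j)

≅-from-↔ : ∀ {G H} (e : Fin (size G) ↔ Fin (size H)) →
           (∀ a b → arc G (Inverse.from e a) (Inverse.from e b) ≡ arc H a b) → G ≅ H
≅-from-↔ {G} {H} e arcs = to , Bijection.bijective (Inverse⇒Bijection e) , λ i j →
  trans (sym (cong₂ (arc G) (strictlyInverseʳ i) (strictlyInverseʳ j))) (arcs (to i) (to j))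
  where open Inverse e

module TwoVertices (G : Digraph) (size≡2 : size G ≡ 2) where

  e : Fin (size G) ↔ Fin 2
  e = subst (λ m → Fin (size G) ↔ Fin m) size≡2 ↔-refl

  open Inverse e using (from; strictlyInverseˡ)

  from0≢from1 : from zero ≢ from (suc zero)
  from0≢from1 eq
    with trans (sym (strictlyInverseˡ zero)) (trans (cong (Inverse.to e) eq) (strictlyInverseˡ (suc zero)))
  ... | ()

  complete≅digon : Complete G → G ≅ digon
  complete≅digon c = ≅-from-↔ {G} {digon} e arcs
    where
    arcs : ∀ a b → arc G (from a) (from b) ≡ digonArc a b
    arcs zero zero = loopless G _
    arcs zero (suc zero) = c _ _ from0≢from1
    arcs (suc zero) zero = c _ _ (from0≢from1 ∘ sym)
    arcs (suc zero) (suc zero) = loopless G _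

  arcK₂-via : (e′ : Fin (size G) ↔ Fin 2) → let from′ = Inverse.from e′ in
    arc G (from′ zero) (from′ (suc zero)) ≡ true → arc G (from′ (suc zero)) (from′ zero) ≡ false →
    G ≅ arcK₂
  arcK₂-via e′ fwd bwd = ≅-from-↔ {G} {arcK₂} e′ arcs
    where
    arcs : ∀ a b → arc G (Inverse.from e′ a) (Inverse.from e′ b) ≡ oneArc a b
    arcs zero zero = loopless G _
    arcs zero (suc zero) = fwd
    arcs (suc zero) zero = bwd
    arcs (suc zero) (suc zero) = loopless G _

  tournament≅arcK₂ : Tournament G → G ≅ arcK₂
  tournament≅arcK₂ t with arc G (from zero) (from (suc zero)) in eq
  ... | true = arcK₂-via e eq (trans (t _ _ from0≢from1) (cong not eq))
  ... | false = arcK₂-via (↔-trans e (transpose zero (suc zero)))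
                  (trans (t _ _ from0≢from1) (cong not eq)) eq

≅-⊑ : ∀ {F H D} → F ≅ H → H ⊑ᵢ D → F ⊑ᵢ D
≅-⊑ (f , (f-inj , _) , f-arc) (g , g-inj , g-arc) =
  g ∘ f , f-inj ∘ g-inj , λ i j → trans (f-arc i j) (g-arc (f i) (f j))

pair : ∀ {n} → Fin n → Fin n → Fin 2 → Fin n
pair u v zero = u
pair u v (suc zero) = v

pair-injective : ∀ {n} {u v : Fin n} → u ≢ v → Injective _≡_ _≡_ (pair u v)
pair-injective u≢v {zero} {zero} _ = refl
pair-injective u≢v {zero} {suc zero} eq = contradiction eq u≢v
pair-injective u≢v {suc zero} {zero} eq = contradiction (sym eq) u≢v
pair-injective u≢v {suc zero} {suc zero} _ = refl

module _ (D : Digraph) {u v : Fin (size D)} (u≢v : u ≢ v) (uv : arc D u v ≡ true) where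

  digon-⊑ : arc D v u ≡ true → digon ⊑ᵢ D
  digon-⊑ vu = pair u v , pair-injective u≢v , arcs
    where
    arcs : ∀ a b → digonArc a b ≡ arc D (pair u v a) (pair u v b)
    arcs zero zero = sym (loopless D u)
    arcs zero (suc zero) = sym uv
    arcs (suc zero) zero = sym vu
    arcs (suc zero) (suc zero) = sym (loopless D v)

  arcK₂-⊑ : arc D v u ≡ false → arcK₂ ⊑ᵢ D
  arcK₂-⊑ vu = pair u v , pair-injective u≢v , arcs
    where
    arcs : ∀ a b → oneArc a b ≡ arc D (pair u v a) (pair u v b)
    arcs zero zero = sym (loopless D u)
    arcs zero (suc zero) = sym uv
    arcs (suc zero) zero = sym vu
    arcs (suc zero) (suc zero) = sym (loopless D v)

arc⇒≢ : ∀ D {u v} → arc D u v ≡ true → u ≢ v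
arc⇒≢ D {u} uv refl with trans (sym uv) (loopless D u)
... | ()

arcless : ∀ D → ¬ digon ⊑ᵢ D → ¬ arcK₂ ⊑ᵢ D → ∀ u v → arc D u v ≢ true
arcless D ¬digon ¬arcK₂ u v uv with arc D v u in vu
... | true = ¬digon (digon-⊑ D (arc⇒≢ D uv) uv vu)
... | false = ¬arcK₂ (arcK₂-⊑ D (arc⇒≢ D uv) uv vu)

heroic-digon-arcK₂ : ∀ F₁ F₂ → F₁ ≅ digon → F₂ ≅ arcK₂ → Heroic₂ F₁ F₂
heroic-digon-arcK₂ F₁ F₂ F₁≅ F₂≅ = 1 , λ D (¬F₁ , ¬F₂) → (λ _ → zero) , λ _ cycle →
  arcless D (¬F₁ ∘ ≅-⊑ {F₁} {digon} {D} F₁≅) (¬F₂ ∘ ≅-⊑ {F₂} {arcK₂} {D} F₂≅) _ _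
    (DirCycleIn.close cycle)

resolve : ∀ {A B : Set} → ¬ A → A ⊎ B → B
resolve ¬a = fromInj₂ (⊥-elim ∘ ¬a)

heroic-with-complete : ∀ F G → 2 ≤ size F → 2 ≤ size G → Complete F →
  Tournament F ⊎ Tournament G → OrientedTriangleFree F ⊎ OrientedTriangleFree G →
  SymmetricTriangleFree F ⊎ SymmetricTriangleFree G → F ≅ digon × G ≅ arcK₂
heroic-with-complete F G 2≤F 2≤G cF tourn otf stf =
  TwoVertices.complete≅digon F
    (semicomplete-triangleFree⇒size≡2 F 2≤F (complete⇒semicomplete {F} cF) (proj₂ stfF)) cF ,
  TwoVertices.tournament≅arcK₂ G
    (semicomplete-triangleFree⇒size≡2 G 2≤G (tournament⇒semicomplete {G} tG) (proj₂ otfG)) tG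
  where
  tG : Tournament G
  tG = resolve (complete⇒¬tournament F 2≤F cF) tourn
  otfG : OrientedTriangleFree G
  otfG = resolve (complete⇒¬oriented F 2≤F cF ∘ proj₁) otf
  stfF : SymmetricTriangleFree F
  stfF = resolve (tournament⇒¬symmetric G 2≤G tG ∘ proj₁) (Sum.swap stf)

lastOf : ∀ {A : Set} → A → List A → A
lastOf x [] = x
lastOf x (y ∷ ys) = lastOf y ys

record Cycle {A : Set} (R : A → A → Set) (P : A → Set) : Set where
  constructor cycle
  field
    start  : A
    rest   : List A
    path   : Linked R (start ∷ rest)
    back   : R (lastOf start rest) start
    unique : Unique (start ∷ rest)
    inside : All P (start ∷ rest)

lastOf-map : ∀ {A B : Set} (f : A → B) x xs → lastOf (f x) (map f xs) ≡ f (lastOf x xs)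
lastOf-map f x [] = refl
lastOf-map f x (y ∷ ys) = lastOf-map f y ys

map-Cycle : ∀ {A B : Set} {R : A → A → Set} {S : B → B → Set} {P : A → Set} {Q : B → Set}
  (f : A → B) → Injective _≡_ _≡_ f → (∀ {u v} → R u v → S (f u) (f v)) → (∀ {u} → P u → Q (f u)) →
  Cycle R P → Cycle S Q
map-Cycle {S = S} f f-inj f-R f-P (cycle x xs path back unique inside) = cycle (f x) (map f xs)
  (Linked.map⁺ (Linked.map f-R path))
  (subst (λ y → S y (f x)) (sym (lastOf-map f x xs)) (f-R back))
  (Unique.map⁺ f-inj unique)
  (All.map⁺ (All.map f-P inside))

lookup-injective : ∀ {A : Set} {xs : List A} → Unique xs → Injective _≡_ _≡_ (List.lookup xs)
lookup-injective {xs = x ∷ xs} _ {zero} {zero} _ = refl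
lookup-injective {xs = x ∷ xs} (x∉xs ∷ _) {zero} {suc j} eq =
  contradiction eq (All.lookup x∉xs (∈-lookup j))
lookup-injective {xs = x ∷ xs} (x∉xs ∷ _) {suc i} {zero} eq =
  contradiction (sym eq) (All.lookup x∉xs (∈-lookup i))
lookup-injective {xs = x ∷ xs} (_ ∷ unique) {suc i} {suc j} eq = cong suc (lookup-injective unique eq)

lookup-Linked : ∀ {A : Set} {R : A → A → Set} x (xs : List A) → Linked R (x ∷ xs) →
  ∀ i → R (List.lookup (x ∷ xs) (inject₁ i)) (List.lookup xs i)
lookup-Linked x (y ∷ ys) (r ∷ _) zero = r
lookup-Linked x (y ∷ ys) (_ ∷ rs) (suc i) = lookup-Linked y ys rs i

lookup-last : ∀ {A : Set} (x : A) xs → List.lookup (x ∷ xs) (fromℕ (length xs)) ≡ lastOf x xs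
lookup-last x [] = refl
lookup-last x (y ∷ ys) = lookup-last y ys

Cycle⇒DirCycleIn : ∀ D {P} → Cycle (λ i j → arc D i j ≡ true) P → DirCycleIn D P
Cycle⇒DirCycleIn D (cycle x [] _ back _ _) with trans (sym back) (loopless D x)
... | ()
Cycle⇒DirCycleIn D {P} (cycle x xs@(_ ∷ _) path back unique inside) = record
  { len = length xs
  ; len≥1 = s≤s z≤n
  ; vert = List.lookup (x ∷ xs)
  ; inj = lookup-injective unique
  ; step = lookup-Linked x xs path
  ; close = subst (λ y → arc D y x ≡ true) (sym (lookup-last x xs)) back
  ; inside = λ i → All.lookup inside (∈-lookup i)
  }

record FinDigraph : Set₁ where
  field
    Vertex        : Set
    order         : ℕ
    enum          : Fin order ↔ Vertex
    hasArc        : Vertex → Vertex → Bool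
    hasArc-irrefl : ∀ v → hasArc v v ≡ false

  open Inverse enum public using (to; from; strictlyInverseˡ; strictlyInverseʳ)

  Arc : Vertex → Vertex → Set
  Arc u v = hasArc u v ≡ true

  digraph : Digraph
  digraph = record
    { size = order
    ; arc = λ i j → hasArc (to i) (to j)
    ; loopless = λ i → hasArc-irrefl (to i)
    }

  to-injective : Injective _≡_ _≡_ to
  to-injective {i} {j} eq = trans (sym (strictlyInverseʳ i)) (trans (cong from eq) (strictlyInverseʳ j))

  from-injective : Injective _≡_ _≡_ from
  from-injective {u} {v} eq = trans (sym (strictlyInverseˡ u)) (trans (cong to eq) (strictlyInverseˡ v))

open FinDigraph using (Vertex; Arc; digraph)

⊎-enum : ∀ {A B : Set} {m n} → Fin m ↔ A → Fin n ↔ B → Fin (m + n) ↔ (A ⊎ B)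
⊎-enum eA eB = ↔-trans +↔⊎ (eA ⊎-↔ eB)

×-enum : ∀ {A B : Set} {m n} → Fin m ↔ A → Fin n ↔ B → Fin (m * n) ↔ (A × B)
×-enum eA eB = ↔-trans *↔× (eA ×-↔ eB)

Vec-enum : ∀ {A : Set} {n} k → Fin n ↔ A → Fin (n ^ k) ↔ Vec A k
Vec-enum zero _ = ↔-trans 1↔⊤ (mk↔ₛ′ (λ _ → []) (λ _ → tt) (λ { [] → refl }) (λ _ → refl))
Vec-enum (suc k) e =
  ↔-trans (×-enum e (Vec-enum k e)) (mk↔ₛ′ (uncurry _∷_) uncons (λ { (_ ∷ _) → refl }) (λ _ → refl))

module _ (G : FinDigraph) where
  open FinDigraph G using (to; hasArc)

  Adjacentᵛ : Vertex G → Vertex G → Set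
  Adjacentᵛ u v = Arc G u v ⊎ Arc G v u

  Orientedᵛ Symmetricᵛ TriangleFreeᵛ : Set
  Orientedᵛ = ∀ u v → Arc G u v → hasArc v u ≡ false
  Symmetricᵛ = ∀ u v → hasArc u v ≡ hasArc v u
  TriangleFreeᵛ = ∀ u v w → ¬ (Adjacentᵛ u v × Adjacentᵛ v w × Adjacentᵛ u w)

  Orientedᵛ⇒Oriented : Orientedᵛ → Oriented (digraph G)
  Orientedᵛ⇒Oriented o i j = o (to i) (to j)

  Symmetricᵛ⇒Symmetric : Symmetricᵛ → Symmetric (digraph G)
  Symmetricᵛ⇒Symmetric s i j = s (to i) (to j)

  TriangleFreeᵛ⇒TriangleFree : TriangleFreeᵛ → TriangleFree (digraph G)
  TriangleFreeᵛ⇒TriangleFree t i j k = t (to i) (to j) (to k)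

adjacent⇒≢ : ∀ G {u v} → Adjacentᵛ G u v → u ≢ v
adjacent⇒≢ G {u} (inj₁ uu) refl = contradiction (trans (sym uu) (FinDigraph.hasArc-irrefl G u)) λ ()
adjacent⇒≢ G {u} (inj₂ uu) refl = contradiction (trans (sym uu) (FinDigraph.hasArc-irrefl G u)) λ ()

AcyclicColouring : ∀ {k} (G : FinDigraph) → (Vertex G → Fin k) → Set
AcyclicColouring G col = ∀ a → ¬ Cycle (Arc G) (λ v → col v ≡ a)

NoAcyclicColouring : FinDigraph → ℕ → Set
NoAcyclicColouring G k = ∀ (col : Vertex G → Fin k) → ¬ AcyclicColouring G col

NoAcyclicColouring⇒¬DichromaticAtMost : ∀ G k → NoAcyclicColouring G k → ¬ DichromaticAtMost (digraph G) k
NoAcyclicColouring⇒¬DichromaticAtMost G k none (col , acyclic) =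
  none (col ∘ from) λ a →
    acyclic a ∘ Cycle⇒DirCycleIn (digraph G) ∘ map-Cycle from from-injective arc-from (λ p → p)
  where
  open FinDigraph G using (hasArc; to; from; from-injective; strictlyInverseˡ)
  arc-from : ∀ {u v} → Arc G u v → hasArc (to (from u)) (to (from v)) ≡ true
  arc-from {u} {v} uv = trans (cong₂ hasArc (strictlyInverseˡ u) (strictlyInverseˡ v)) uv

record Embedding (G H : FinDigraph) : Set where
  field
    embed     : Vertex G → Vertex H
    injective : Injective _≡_ _≡_ embed
    arcs      : ∀ {u v} → Arc G u v → Arc H (embed u) (embed v)

recolour : ∀ {G H m k} (e : Embedding G H) {col′ : Vertex G → Fin m} {col : Vertex H → Fin k}
  (σ : Fin m → Fin k) → (∀ v → σ (col′ v) ≡ col (Embedding.embed e v)) →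
  AcyclicColouring H col → AcyclicColouring G col′
recolour e σ commutes acyclic a = acyclic (σ a) ∘ map-Cycle embed injective arcs
  (λ {v} p → trans (sym (commutes v)) (cong σ p))
  where open Embedding e

missing-colour : ∀ {G H n} (e : Embedding G H) {col : Vertex H → Fin (suc n)} {c} →
  (∀ v → c ≢ col (Embedding.embed e v)) → AcyclicColouring H col → ¬ NoAcyclicColouring G n
missing-colour e {c = c} avoids acyclic none =
  none (λ v → punchOut (avoids v)) (recolour e (punchIn c) (λ v → punchIn-punchOut (avoids v)) acyclic)

NoAcyclicColouring⇒Unbounded : ∀ {𝒞 : Digraph → Set} →
  (∀ k → Σ FinDigraph λ G → 𝒞 (digraph G) × NoAcyclicColouring G k) → Unbounded 𝒞
NoAcyclicColouring⇒Unbounded family k with G , G∈𝒞 , none ← family k =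
  digraph G , G∈𝒞 , NoAcyclicColouring⇒¬DichromaticAtMost G k none

-- Complete symmetric digraphs and tournaments

completeDigraph : ℕ → FinDigraph
completeDigraph k = record
  { Vertex = Fin k
  ; order = k
  ; enum = ↔-refl
  ; hasArc = λ i j → not (does (i ≟ j))
  ; hasArc-irrefl = λ i → cong not (dec-true (i ≟ i) refl)
  }

completeDigraph-isComplete : ∀ k → Complete (digraph (completeDigraph k))
completeDigraph-isComplete k i j i≢j = cong not (dec-false (i ≟ j) i≢j)

completeDigraph-noAcyclicColouring : ∀ k → NoAcyclicColouring (completeDigraph (suc k)) k
completeDigraph-noAcyclicColouring k col acyclic with i , j , i<j , same ← pigeonhole (n<1+n k) col =
  acyclic (col i) (cycle i (j ∷ []) (complete i≢j ∷ [-]) (complete (i≢j ∘ sym))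
                         ((i≢j ∷ []) ∷ [] ∷ []) (refl ∷ sym same ∷ []))
  where
  i≢j : i ≢ j
  i≢j = <⇒≢ i<j
  complete : ∀ {u v} → u ≢ v → not (does (u ≟ v)) ≡ true
  complete = completeDigraph-isComplete (suc k) _ _

complete-unbounded : Unbounded Complete
complete-unbounded = NoAcyclicColouring⇒Unbounded λ k →
  completeDigraph (suc k) , completeDigraph-isComplete (suc k) , completeDigraph-noAcyclicColouring k

module Tournaments where

  Player : ℕ → Set
  Player zero = ⊤
  Player (suc n) = ⊤ ⊎ (Player n ⊎ Player n)

  pattern apex = inj₁ tt
  pattern left a = inj₂ (inj₁ a)
  pattern right b = inj₂ (inj₂ b)

  beats : ∀ n → Player n → Player n → Bool
  beats zero _ _ = false
  beats (suc n) apex (left _) = true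
  beats (suc n) (left _) (right _) = true
  beats (suc n) (right _) apex = true
  beats (suc n) (left a) (left a′) = beats n a a′
  beats (suc n) (right b) (right b′) = beats n b b′
  beats (suc n) _ _ = false

  beats-irrefl : ∀ n u → beats n u u ≡ false
  beats-irrefl zero _ = refl
  beats-irrefl (suc n) apex = refl
  beats-irrefl (suc n) (left a) = beats-irrefl n a
  beats-irrefl (suc n) (right b) = beats-irrefl n b

  beats-tournament : ∀ n u v → u ≢ v → beats n v u ≡ not (beats n u v)
  beats-tournament zero tt tt u≢v = contradiction refl u≢v
  beats-tournament (suc n) apex apex u≢v = contradiction refl u≢v
  beats-tournament (suc n) apex (left _) _ = refl
  beats-tournament (suc n) apex (right _) _ = refl
  beats-tournament (suc n) (left _) apex _ = refl
  beats-tournament (suc n) (left a) (left a′) u≢v = beats-tournament n a a′ (u≢v ∘ cong left)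
  beats-tournament (suc n) (left _) (right _) _ = refl
  beats-tournament (suc n) (right _) apex _ = refl
  beats-tournament (suc n) (right _) (left _) _ = refl
  beats-tournament (suc n) (right b) (right b′) u≢v = beats-tournament n b b′ (u≢v ∘ cong right)

  order : ℕ → ℕ
  order zero = 1
  order (suc n) = 1 + (order n + order n)

  enum : ∀ n → Fin (order n) ↔ Player n
  enum zero = 1↔⊤
  enum (suc n) = ⊎-enum 1↔⊤ (⊎-enum (enum n) (enum n))

  tournament : ℕ → FinDigraph
  tournament n = record
    { Vertex = Player n ; order = order n ; enum = enum n ; hasArc = beats n ; hasArc-irrefl = beats-irrefl n }

  tournament-isTournament : ∀ n → Tournament (digraph (tournament n))
  tournament-isTournament n i j i≢j = beats-tournament n _ _ (i≢j ∘ FinDigraph.to-injective (tournament n))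

  left-embedding right-embedding : ∀ n → Embedding (tournament n) (tournament (suc n))
  left-embedding n = record { embed = left ; injective = λ { refl → refl } ; arcs = λ uv → uv }
  right-embedding n = record { embed = right ; injective = λ { refl → refl } ; arcs = λ uv → uv }

  tournament-noAcyclicColouring : ∀ n → NoAcyclicColouring (tournament n) n
  tournament-noAcyclicColouring zero col _ with col tt
  ... | ()
  -- The apex and a vertex of each copy in its colour c would form a c-coloured triangle, so some
  -- copy avoids c.
  tournament-noAcyclicColouring (suc n) col acyclic =
    ¬¬-excluded-middle {A = ∃ λ a → col (left a) ≡ c} λ
    { (no ¬left) → missing-colour (left-embedding n) (λ a eq → ¬left (a , sym eq)) acyclic IH
    ; (yes (a , ca)) → ¬¬-excluded-middle {A = ∃ λ b → col (right b) ≡ c} λ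
      { (no ¬right) → missing-colour (right-embedding n) (λ b eq → ¬right (b , sym eq)) acyclic IH
      ; (yes (b , cb)) → acyclic c (cycle apex (left a ∷ right b ∷ []) (refl ∷ refl ∷ [-]) refl
          (((λ ()) ∷ (λ ()) ∷ []) ∷ ((λ ()) ∷ []) ∷ [] ∷ []) (refl ∷ ca ∷ cb ∷ []))
      }
    }
    where
    c : Fin (suc n)
    c = col apex
    IH : NoAcyclicColouring (tournament n) n
    IH = tournament-noAcyclicColouring n

tournament-unbounded : Unbounded Tournament
tournament-unbounded = NoAcyclicColouring⇒Unbounded λ n →
  tournament n , tournament-isTournament n , tournament-noAcyclicColouring n
  where open Tournaments

-- Sinks of acyclic relations, and large colour classes

Unique⇒length≤ : ∀ {n} {xs : List (Fin n)} → Unique xs → length xs ≤ n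
Unique⇒length≤ {n} {xs} unique with length xs ℕ.≤? n
... | yes ≤n = ≤n
... | no ≰n with i , j , i<j , same ← pigeonhole (≰⇒> ≰n) (List.lookup xs) =
  contradiction (lookup-injective unique same) (<⇒≢ i<j)

Unique-∷ʳ : ∀ {A : Set} {xs : List A} {y} → Unique xs → y ∉ xs → Unique (xs ∷ʳ y)
Unique-∷ʳ {xs = []} [] _ = [] ∷ []
Unique-∷ʳ {xs = x ∷ xs} (x∉xs ∷ unique) y∉ =
  All.∷ʳ⁺ x∉xs (λ x≡y → y∉ (here (sym x≡y))) ∷ Unique-∷ʳ unique (y∉ ∘ there)

Linked-∷ʳ : ∀ {A : Set} {R : A → A → Set} {x xs y} → Linked R (x ∷ xs) → R (lastOf x xs) y →
  Linked R (x ∷ (xs ∷ʳ y))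
Linked-∷ʳ {xs = []} [-] r = r ∷ [-]
Linked-∷ʳ {xs = _ ∷ _} (r ∷ rs) r′ = r ∷ Linked-∷ʳ rs r′

_≢?_ : ∀ {n} → Decidable₂ {A = Fin n} _≢_
y ≢? u = ¬? (y ≟ u)

without : ∀ {n} → Fin n → List (Fin n) → List (Fin n)
without u = filter (_≢? u)

length-without : ∀ {n} {u : Fin n} {xs} → Unique xs → u ∈ xs → length xs ≡ suc (length (without u xs))
length-without {u = u} {x ∷ xs} (x∉xs ∷ _) (here refl)
  rewrite filter-reject (_≢? u) {x} {xs} (λ ¬u≡u → ¬u≡u refl)
  = cong suc (sym (cong length (filter-all (_≢? u) (All.map (λ u≢y y≡u → u≢y (sym y≡u)) x∉xs))))
length-without {u = u} {x ∷ xs} (x∉xs ∷ unique) (there u∈) with x ≟ u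
... | yes refl = contradiction refl (All.lookup x∉xs u∈)
... | no x≢u = cong suc (length-without unique u∈)

close-cycle : ∀ {A : Set} {R : A → A → Set} {P : A → Set} {x xs y} →
  Linked R (x ∷ xs) → Unique (x ∷ xs) → All P (x ∷ xs) → y ∈ x ∷ xs → R (lastOf x xs) y → Cycle R P
close-cycle {x = x} {xs} path unique inside (here refl) back = cycle x xs path back unique inside
close-cycle {xs = _ ∷ _} (_ ∷ path) (_ ∷ unique) (_ ∷ inside) (there y∈) back =
  close-cycle path unique inside y∈ back

module Sinks {n} (R : Fin n → Fin n → Set) {P : Fin n → Set} (acyclic : ¬ Cycle R P) where

  IsSinkIn : List (Fin n) → Fin n → Set
  IsSinkIn L u = u ∈ L × ∀ {y} → y ∈ L → ¬ R u y

  -- Walking forwards inside L either gets stuck at a sink or closes a cycle; a duplicate-free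
  -- walk has at most n vertices, so the fuel never runs out.
  walk : ∀ {L} → All P L → ∀ fuel x xs → Linked R (x ∷ xs) → Unique (x ∷ xs) → All (_∈ L) (x ∷ xs) →
         n < fuel + length (x ∷ xs) → ¬ ¬ ∃ (IsSinkIn L)
  walk L⊆P zero x xs path unique inL bound _ = <⇒≱ bound (Unique⇒length≤ unique)
  walk {L} L⊆P (suc fuel) x xs path unique inL bound ¬sink =
    ¬¬-excluded-middle {A = ∃ λ y → y ∈ L × R (lastOf x xs) y} λ
    { (no stuck) → ¬sink (lastOf x xs , last∈L x xs inL , λ y∈ r → stuck (_ , y∈ , r))
    ; (yes (y , y∈L , r)) → ¬¬-excluded-middle {A = y ∈ x ∷ xs} λ
      { (yes y∈path) → acyclic (close-cycle path unique (All.map (All.lookup L⊆P) inL) y∈path r)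
      ; (no y∉path) → walk L⊆P fuel x (xs ∷ʳ y) (Linked-∷ʳ path r) (Unique-∷ʳ unique y∉path)
                        (All.∷ʳ⁺ inL y∈L) (subst (n <_) (longer xs y) bound) ¬sink
      }
    }
    where
    last∈L : ∀ x xs → All (_∈ L) (x ∷ xs) → lastOf x xs ∈ L
    last∈L x [] (x∈ ∷ []) = x∈
    last∈L x (x′ ∷ xs) (_ ∷ inL) = last∈L x′ xs inL
    longer : ∀ xs y → suc fuel + length (x ∷ xs) ≡ fuel + length (x ∷ (xs ∷ʳ y))
    longer xs y = trans (sym (+-suc fuel (length (x ∷ xs))))
                        (cong (λ m → fuel + suc m) (sym (trans (length-++ xs) (+-comm (length xs) 1))))

  sink : ∀ {L x} → All P L → x ∈ L → ¬ ¬ ∃ (IsSinkIn L)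
  sink L⊆P x∈L = walk L⊆P n _ [] [-] ([] ∷ []) (x∈L ∷ []) (subst (n <_) (sym (+-comm n 1)) ≤-refl)

  record Split (k r : ℕ) (L : List (Fin n)) : Set where
    field
      sinks rest   : List (Fin n)
      length-sinks : k ≤ length sinks
      length-rest  : r ≤ length rest
      unique-sinks : Unique sinks
      unique-rest  : Unique rest
      sinks⊆L      : ∀ {u} → u ∈ sinks → u ∈ L
      rest⊆L       : ∀ {y} → y ∈ rest → y ∈ L
      separated    : ∀ {u y} → u ∈ sinks → y ∈ rest → u ≢ y × ¬ R u y

  -- Split off k successive sinks: each is a sink of what remains after removing the earlier ones.
  split : ∀ k r {L} → Unique L → All P L → k + r ≤ length L → ¬ ¬ Split k r L
  split zero r {L} unique _ r≤ ¬split = ¬split record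
    { sinks = [] ; rest = L ; length-sinks = z≤n ; length-rest = r≤ ; unique-sinks = [] ; unique-rest = unique
    ; sinks⊆L = λ () ; rest⊆L = λ y∈ → y∈ ; separated = λ () }
  split (suc k) r {x ∷ xs} unique L⊆P ≤L ¬split = sink L⊆P (here refl) λ (u , u∈L , u-sink) →
    split k r (Unique.filter⁺ (_≢? u) unique) (All.filter⁺ (_≢? u) L⊆P)
      (≤-pred (subst (suc k + r ≤_) (length-without unique u∈L) ≤L))
      λ s → ¬split (extend u u∈L u-sink s)
    where
    L : List (Fin n)
    L = x ∷ xs
    extend : ∀ u → u ∈ L → (∀ {y} → y ∈ L → ¬ R u y) → Split k r (without u L) → Split (suc k) r L
    extend u u∈L u-sink s = record
      { sinks = u ∷ sinks
      ; rest = rest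
      ; length-sinks = s≤s length-sinks
      ; length-rest = length-rest
      ; unique-sinks =
          All.tabulate (λ z∈ u≡z → proj₂ (removed (sinks⊆L z∈)) (sym u≡z)) ∷ unique-sinks
      ; unique-rest = unique-rest
      ; sinks⊆L = λ { (here refl) → u∈L ; (there z∈) → proj₁ (removed (sinks⊆L z∈)) }
      ; rest⊆L = proj₁ ∘ removed ∘ rest⊆L
      ; separated = λ
        { (here refl) y∈ →
            (λ u≡y → proj₂ (removed (rest⊆L y∈)) (sym u≡y)) , u-sink (proj₁ (removed (rest⊆L y∈)))
        ; (there z∈) y∈ → separated z∈ y∈
        }
      }
      where
      open Split s
      removed : ∀ {y} → y ∈ without u L → y ∈ L × y ≢ u
      removed = ∈-filter⁻ (_≢? u) {xs = L}

length-filter-∁ : ∀ {A : Set} {P : A → Set} (P? : Decidable P) xs →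
  length (filter P? xs) + length (filter (∁? P?) xs) ≡ length xs
length-filter-∁ P? [] = refl
length-filter-∁ P? (x ∷ xs) with does (P? x)
... | true = cong suc (length-filter-∁ P? xs)
... | false = trans (+-suc _ _) (cong suc (length-filter-∁ P? xs))

module _ {A : Set} (f : A → ℕ) where

  coloured : ∀ c → Decidable (λ x → f x ≡ c)
  coloured c x = f x ℕ.≟ c

  large-colour-class-ℕ : ∀ m t {xs : List A} → Unique xs → All (λ x → f x < m) xs →
    m * t < length xs → ∃₂ λ c ys → Unique ys × All (λ y → f y ≡ c) ys × t < length ys
  large-colour-class-ℕ zero t {[]} _ _ ()
  large-colour-class-ℕ zero t {_ ∷ _} _ (fx<0 ∷ _) _ = contradiction fx<0 n≮0
  large-colour-class-ℕ (suc m) t {xs} unique bounded big with t ℕ.<? length (filter (coloured m) xs)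
  ... | yes large = m , _ , Unique.filter⁺ (coloured m) unique , All.all-filter (coloured m) xs , large
  ... | no small = large-colour-class-ℕ m t (Unique.filter⁺ others unique)
          (All.zipWith (λ (fx<1+m , fx≢m) → ≤∧≢⇒< (≤-pred fx<1+m) fx≢m)
            (All.filter⁺ others bounded , All.all-filter others xs))
          rest-big
    where
    others : Decidable (λ x → ¬ f x ≡ m)
    others = ∁? (coloured m)
    rest-big : m * t < length (filter others xs)
    rest-big with m * t ℕ.<? length (filter others xs)
    ... | yes p = p
    ... | no q = contradiction
      (subst (_≤ t + m * t) (length-filter-∁ (coloured m) xs) (+-mono-≤ (≮⇒≥ small) (≮⇒≥ q)))
      (<⇒≱ big)

large-colour-class : ∀ {A : Set} {m} (col : A → Fin m) t {xs : List A} → Unique xs →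
  m * t < length xs → ∃₂ λ c ys → Unique ys × All (λ y → col y ≡ c) ys × t < length ys
large-colour-class {m = m} col t {xs} unique big
  with large-colour-class-ℕ (toℕ ∘ col) m t unique (All.tabulate (λ {x} _ → toℕ<n (col x))) big
... | _ , [] , _ , _ , ()
... | _ , y ∷ ys , unique′ , same ∷ sames , longer =
  col y , y ∷ ys , unique′ ,
  refl ∷ All.map (λ same′ → toℕ-injective (trans same′ (sym same))) sames , longer

pick : ∀ {A : Set} (xs : List A) {k} → k ≤ length xs → Fin k → A
pick xs k≤ i = List.lookup xs (inject≤ i k≤)

pick-∈ : ∀ {A : Set} (xs : List A) {k} (k≤ : k ≤ length xs) i → pick xs k≤ i ∈ xs
pick-∈ xs k≤ i = ∈-lookup (inject≤ i k≤)

pick-injective : ∀ {A : Set} {xs : List A} {k} (k≤ : k ≤ length xs) → Unique xs →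
  Injective _≡_ _≡_ (pick xs k≤)
pick-injective k≤ unique {i} {j} same = inject≤-injective k≤ k≤ i j (lookup-injective unique same)

-- Triangle-free oriented digraphs of large dichromatic number

decided : ∀ {A : Set} (a? : Dec A) → does a? ≡ true → A
decided (yes a) _ = a

record TriangleFreeOriented (n : ℕ) : Set₁ where
  field
    graph         : FinDigraph
    oriented      : Orientedᵛ graph
    triangle-free : TriangleFreeᵛ graph
    no-colouring  : NoAcyclicColouring graph n

module Tutte {n} (D : TriangleFreeOriented n) where
  open TriangleFreeOriented D
  open FinDigraph graph using (order; enum; from; from-injective; hasArc; hasArc-irrefl)

  -- With N anchors, every (suc n)-colouring has a colour class of more than s + s anchors.
  s N : ℕ
  s = order
  N = suc (suc n * (s + s))

  Frame : Set
  Frame = Vec (Fin N) s × Vec (Fin N) s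

  source target : Frame → Vertex graph → Fin N
  source (us , _) d = lookup us (from d)
  target (_ , ws) d = lookup ws (from d)

  InjectiveTuple : Vec (Fin N) s → Set
  InjectiveTuple v = ∀ i j → lookup v i ≡ lookup v j → i ≡ j

  Proper : Frame → Set
  Proper (us , ws) = InjectiveTuple us × InjectiveTuple ws × (∀ i j → lookup us i ≢ lookup ws j)

  proper? : ∀ g → Dec (Proper g)
  proper? (us , ws) =
    injective? us ×-dec injective? ws ×-dec (all? λ i → all? λ j → ¬? (lookup us i ≟ lookup ws j))
    where
    injective? : ∀ v → Dec (InjectiveTuple v)
    injective? v = all? λ i → all? λ j → (lookup v i ≟ lookup v j) →-dec (i ≟ j)

  _≟ᶠ_ : (g h : Frame) → Dec (g ≡ h)
  _≟ᶠ_ = ×-≡-dec (Vec.≡-dec _≟_) (Vec.≡-dec _≟_)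

  Vertex′ : Set
  Vertex′ = Fin N ⊎ (Frame × Vertex graph)

  pattern anchor x = inj₁ x
  pattern copy g d = inj₂ (g , d)

  Arc′ : Vertex′ → Vertex′ → Set
  Arc′ (anchor _) (anchor _) = ⊥
  Arc′ (anchor x) (copy g d) = Proper g × source g d ≡ x
  Arc′ (copy g d) (anchor y) = Proper g × target g d ≡ y
  Arc′ (copy g d) (copy h e) = g ≡ h × Arc graph d e

  arc? : ∀ u v → Dec (Arc′ u v)
  arc? (anchor _) (anchor _) = no λ ()
  arc? (anchor x) (copy g d) = proper? g ×-dec source g d ≟ x
  arc? (copy g d) (anchor y) = proper? g ×-dec target g d ≟ y
  arc? (copy g d) (copy h e) = (g ≟ᶠ h) ×-dec (hasArc d e Bool.≟ true)

  Arc′-irrefl : ∀ v → ¬ Arc′ v v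
  Arc′-irrefl (copy g d) (_ , dd) = contradiction (trans (sym dd) (hasArc-irrefl d)) λ ()

  next : FinDigraph
  next = record
    { Vertex = Vertex′
    ; order = N + (N ^ s * N ^ s) * s
    ; enum = ⊎-enum ↔-refl (×-enum (×-enum (Vec-enum s ↔-refl) (Vec-enum s ↔-refl)) enum)
    ; hasArc = λ u v → does (arc? u v)
    ; hasArc-irrefl = λ v → dec-false (arc? v v) (Arc′-irrefl v)
    }

  arc⇒ : ∀ {u v} → Arc next u v → Arc′ u v
  arc⇒ {u} {v} = decided (arc? u v)

  ⇒arc : ∀ u v → Arc′ u v → Arc next u v
  ⇒arc u v = dec-true (arc? u v)

  next-oriented : Orientedᵛ next
  next-oriented u v uv = dec-false (arc? v u) (no-digon u v (arc⇒ uv))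
    where
    no-digon : ∀ u v → Arc′ u v → ¬ Arc′ v u
    no-digon (anchor x) (copy g d) ((_ , _ , disjoint) , sx) (_ , tx) = disjoint _ _ (trans sx (sym tx))
    no-digon (copy g d) (anchor x) ((_ , _ , disjoint) , tx) (_ , sx) = disjoint _ _ (trans sx (sym tx))
    no-digon (copy g d) (copy h e) (_ , de) (_ , ed) = contradiction (trans (sym ed) (oriented d e de)) λ ()

  Adjacent′ : Vertex′ → Vertex′ → Set
  Adjacent′ u v = Arc′ u v ⊎ Arc′ v u

  Touches : Frame → Vertex graph → Fin N → Set
  Touches g d x = source g d ≡ x ⊎ target g d ≡ x

  anchors-nonadjacent : ∀ {x y} → ¬ Adjacent′ (anchor x) (anchor y)
  anchors-nonadjacent (inj₁ ())
  anchors-nonadjacent (inj₂ ())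

  anchor-copy : ∀ {x g d} → Adjacent′ (anchor x) (copy g d) → Proper g × Touches g d x
  anchor-copy (inj₁ (proper , sx)) = proper , inj₁ sx
  anchor-copy (inj₂ (proper , tx)) = proper , inj₂ tx

  copy-copy : ∀ {g d h e} → Adjacent′ (copy g d) (copy h e) → g ≡ h × Adjacentᵛ graph d e
  copy-copy (inj₁ (g≡h , de)) = g≡h , inj₁ de
  copy-copy (inj₂ (h≡g , ed)) = sym h≡g , inj₂ ed

  adjacent-positions : ∀ {d e} → Adjacentᵛ graph d e → from d ≢ from e
  adjacent-positions de = adjacent⇒≢ graph de ∘ from-injective

  no-common-anchor : ∀ {g d e x} → Proper g → Adjacentᵛ graph d e → Touches g d x → Touches g e x → ⊥
  no-common-anchor (us-injective , _ , _) de (inj₁ sd) (inj₁ se) =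
    adjacent-positions de (us-injective _ _ (trans sd (sym se)))
  no-common-anchor (_ , ws-injective , _) de (inj₂ td) (inj₂ te) =
    adjacent-positions de (ws-injective _ _ (trans td (sym te)))
  no-common-anchor {d = d} {e} (_ , _ , disjoint) _ (inj₁ sd) (inj₂ te) =
    disjoint (from d) (from e) (trans sd (sym te))
  no-common-anchor {d = d} {e} (_ , _ , disjoint) _ (inj₂ td) (inj₁ se) =
    disjoint (from e) (from d) (trans se (sym td))

  anchor-triangle : ∀ x {g d h e} → Adjacent′ (anchor x) (copy g d) → Adjacent′ (anchor x) (copy h e) →
                    ¬ Adjacent′ (copy g d) (copy h e)
  anchor-triangle x {g} {d} {h} {e} xd xe de
    with copy-copy {g} {d} {h} {e} de | anchor-copy {x} {g} {d} xd | anchor-copy {x} {h} {e} xe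
  ... | refl , de′ | proper , xd′ | _ , xe′ = no-common-anchor {g} {d} {e} {x} proper de′ xd′ xe′

  no-triangle : ∀ u v w → ¬ (Adjacent′ u v × Adjacent′ v w × Adjacent′ u w)
  no-triangle (anchor x) (anchor y) _ (xy , _ , _) = anchors-nonadjacent {x} {y} xy
  no-triangle (anchor x) _ (anchor z) (_ , _ , xz) = anchors-nonadjacent {x} {z} xz
  no-triangle _ (anchor y) (anchor z) (_ , yz , _) = anchors-nonadjacent {y} {z} yz
  no-triangle (anchor x) (copy g d) (copy h e) (xd , de , xe) = anchor-triangle x {g} {d} {h} {e} xd xe de
  no-triangle (copy g d) (anchor x) (copy h e) (dx , xe , de) =
    anchor-triangle x {g} {d} {h} {e} (Sum.swap dx) xe de
  no-triangle (copy g d) (copy h e) (anchor x) (de , ex , dx) =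
    anchor-triangle x {g} {d} {h} {e} (Sum.swap dx) (Sum.swap ex) de
  no-triangle (copy g d) (copy h e) (copy k f) (de , ef , df)
    with copy-copy {g} {d} {h} {e} de | copy-copy {h} {e} {k} {f} ef | copy-copy {g} {d} {k} {f} df
  ... | refl , de′ | refl , ef′ | _ , df′ = triangle-free d e f (de′ , ef′ , df′)

  next-triangleFree : TriangleFreeᵛ next
  next-triangleFree u v w (uv , vw , uw) = no-triangle u v w (adjacent uv , adjacent vw , adjacent uw)
    where
    adjacent : ∀ {u v} → Adjacentᵛ next u v → Adjacent′ u v
    adjacent = Sum.map arc⇒ arc⇒

  module Lift (col : Vertex′ → Fin (suc n)) (c : Fin (suc n)) where

    _⇝_ : Fin N → Fin N → Set
    x ⇝ y = ∃₂ λ g d → Proper g × source g d ≡ x × target g d ≡ y × col (copy g d) ≡ c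

    via : ∀ {x y} → x ⇝ y → Vertex′
    via (g , d , _) = copy g d

    into : ∀ {x y} (p : x ⇝ y) → Arc next (anchor x) (via p)
    into {x} (g , d , proper , sx , _) = ⇒arc (anchor x) (copy g d) (proper , sx)

    out-of : ∀ {x y} (p : x ⇝ y) → Arc next (via p) (anchor y)
    out-of {y = y} (g , d , proper , _ , ty , _) = ⇒arc (copy g d) (anchor y) (proper , ty)

    key : Vertex′ → Fin N
    key (anchor x) = x
    key (copy g d) = source g d

    key-via : ∀ {x y} (p : x ⇝ y) → key (via p) ≡ x
    key-via (_ , _ , _ , sx , _ , _) = sx

    colour-via : ∀ {x y} (p : x ⇝ y) → col (via p) ≡ c
    colour-via (_ , _ , _ , _ , _ , cc) = cc

    detour : ∀ {x₀} x xs → Linked _⇝_ (x ∷ xs) → lastOf x xs ⇝ x₀ → List Vertex′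
    detour x [] [-] p₀ = via p₀ ∷ []
    detour x (y ∷ ys) (p ∷ ps) p₀ = via p ∷ anchor y ∷ detour y ys ps p₀

    module _ {x₀ : Fin N} where

      detour-linked : ∀ x xs ps (p₀ : lastOf x xs ⇝ x₀) →
                      Linked (Arc next) (anchor x ∷ detour x xs ps p₀)
      detour-linked x [] [-] p₀ = into p₀ ∷ [-]
      detour-linked x (y ∷ ys) (p ∷ ps) p₀ = into p ∷ out-of p ∷ detour-linked y ys ps p₀

      detour-last : ∀ x xs ps (p₀ : lastOf x xs ⇝ x₀) → lastOf (anchor x) (detour x xs ps p₀) ≡ via p₀
      detour-last x [] [-] p₀ = refl
      detour-last x (y ∷ ys) (p ∷ ps) p₀ = detour-last y ys ps p₀

      detour-colour : ∀ x xs ps (p₀ : lastOf x xs ⇝ x₀) → All (λ y → col (anchor y) ≡ c) (x ∷ xs) →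
                      All (λ v → col v ≡ c) (anchor x ∷ detour x xs ps p₀)
      detour-colour x [] [-] p₀ (cx ∷ []) = cx ∷ colour-via p₀ ∷ []
      detour-colour x (y ∷ ys) (p ∷ ps) p₀ (cx ∷ cs) = cx ∷ colour-via p ∷ detour-colour y ys ps p₀ cs

      detour-keys : ∀ x xs ps (p₀ : lastOf x xs ⇝ x₀) →
                    All (λ v → key v ∈ x ∷ xs) (detour x xs ps p₀)
      detour-keys x [] [-] p₀ = here (key-via p₀) ∷ []
      detour-keys x (y ∷ ys) (p ∷ ps) p₀ =
        here (key-via p) ∷ there (here refl) ∷ All.map there (detour-keys y ys ps p₀)

      -- Distinct anchors, and copy vertices keyed by distinct anchors, keep the detour duplicate-free.
      detour-unique : ∀ x xs ps (p₀ : lastOf x xs ⇝ x₀) → Unique (x ∷ xs) →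
                      Unique (anchor x ∷ detour x xs ps p₀)
      detour-unique x [] [-] p₀ _ = ((λ ()) ∷ []) ∷ [] ∷ []
      detour-unique x (y ∷ ys) (p ∷ ps) p₀ (x∉ ∷ unique) =
        ((λ ()) ∷ x≢y ∷ avoids keys x∉) ∷ ((λ ()) ∷ avoids keys via∉) ∷ detour-unique y ys ps p₀ unique
        where
        keys : All (λ v → key v ∈ y ∷ ys) (detour y ys ps p₀)
        keys = detour-keys y ys ps p₀
        x≢y : anchor x ≢ anchor y
        x≢y refl = All.lookup x∉ (here refl) refl
        via∉ : All (key (via p) ≢_) (y ∷ ys)
        via∉ = subst (λ z → All (z ≢_) (y ∷ ys)) (sym (key-via p)) x∉
        avoids : ∀ {v zs vs} → All (λ u → key u ∈ zs) vs → All (key v ≢_) zs → All (v ≢_) vs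
        avoids keys fresh =
          All.map (λ key∈ v≡u → All.lookup fresh (subst (λ u → key u ∈ _) (sym v≡u) key∈) refl) keys

    lift-cycle : Cycle _⇝_ (λ x → col (anchor x) ≡ c) → Cycle (Arc next) (λ v → col v ≡ c)
    lift-cycle (cycle x xs ps p₀ unique inside) = cycle (anchor x) (detour x xs ps p₀)
      (detour-linked x xs ps p₀)
      (subst (λ v → Arc next v (anchor x)) (sym (detour-last x xs ps p₀)) (out-of p₀))
      (detour-unique x xs ps p₀ unique)
      (detour-colour x xs ps p₀ inside)

  copy-embedding : Frame → Embedding graph next
  copy-embedding g = record
    { embed = copy g
    ; injective = λ { refl → refl }
    ; arcs = λ {d} {e} de → ⇒arc (copy g d) (copy g e) (refl , de)
    }

  tabulate-injective : ∀ {f : Fin s → Fin N} → Injective _≡_ _≡_ f → InjectiveTuple (tabulate f)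
  tabulate-injective {f} f-injective i j same =
    f-injective (trans (sym (Vec.lookup∘tabulate f i)) (trans same (Vec.lookup∘tabulate f j)))

  lookup-tabulate-∈ : ∀ {xs : List (Fin N)} {f : Fin s → Fin N} → (∀ i → f i ∈ xs) →
                      ∀ i → lookup (tabulate f) i ∈ xs
  lookup-tabulate-∈ {xs} {f} f∈ i = subst (_∈ xs) (sym (Vec.lookup∘tabulate f i)) (f∈ i)

  many-anchors : suc n * (s + s) < length (allFin N)
  many-anchors = subst (suc n * (s + s) <_) (sym (length-tabulate (λ x → x))) ≤-refl

  next-noAcyclicColouring : NoAcyclicColouring next (suc n)
  next-noAcyclicColouring col acyclic
    with c , class , unique , coloured , big
         ← large-colour-class (col ∘ anchor) (s + s) (Unique.allFin⁺ N) many-anchors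
    = split s s unique coloured (<⇒≤ big) frame-avoids-c
    where
    open Lift col c
    open Sinks _⇝_ {P = λ x → col (anchor x) ≡ c} (acyclic c ∘ lift-cycle)
    -- The frame (sinks, rest) is proper, and its copy cannot use colour c: a c-coloured vertex d
    -- of the copy would give an arc source ⇝ target out of a sink into the rest.
    frame-avoids-c : ¬ Split s s class
    frame-avoids-c parts = ¬¬-excluded-middle {A = ∃ λ d → col (copy g d) ≡ c} λ
      { (yes (d , cd)) → proj₂ (separated (us∈ (from d)) (ws∈ (from d))) (g , d , proper , refl , refl , cd)
      ; (no ¬cd) → missing-colour (copy-embedding g) (λ d c≡ → ¬cd (d , sym c≡)) acyclic no-colouring
      }
      where
      open Split parts
      g : Frame
      g = tabulate (pick sinks length-sinks) , tabulate (pick rest length-rest)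
      us∈ : ∀ i → lookup (proj₁ g) i ∈ sinks
      us∈ = lookup-tabulate-∈ (pick-∈ sinks length-sinks)
      ws∈ : ∀ i → lookup (proj₂ g) i ∈ rest
      ws∈ = lookup-tabulate-∈ (pick-∈ rest length-rest)
      proper : Proper g
      proper = tabulate-injective (pick-injective length-sinks unique-sinks) ,
               tabulate-injective (pick-injective length-rest unique-rest) ,
               λ i j → proj₁ (separated (us∈ i) (ws∈ j))

  tutte : TriangleFreeOriented (suc n)
  tutte = record
    { graph = next
    ; oriented = next-oriented
    ; triangle-free = next-triangleFree
    ; no-colouring = next-noAcyclicColouring
    }

triangleFreeOriented : ∀ n → TriangleFreeOriented n
triangleFreeOriented zero = record
  { graph = record
    { Vertex = ⊤ ; order = 1 ; enum = 1↔⊤ ; hasArc = λ _ _ → false ; hasArc-irrefl = λ _ → refl }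
  ; oriented = λ _ _ ()
  ; triangle-free = λ { _ _ _ (inj₁ () , _) ; _ _ _ (inj₂ () , _) }
  ; no-colouring = λ col _ → case col tt of λ () }
triangleFreeOriented (suc n) = Tutte.tutte (triangleFreeOriented n)

symmetrise : FinDigraph → FinDigraph
symmetrise G = record G
  { hasArc = λ u v → hasArc u v ∨ hasArc v u
  ; hasArc-irrefl = λ v → cong₂ _∨_ (hasArc-irrefl v) (hasArc-irrefl v)
  }
  where open FinDigraph G

module _ (G : FinDigraph) where
  open FinDigraph G using (hasArc)

  symmetrise-symmetric : Symmetricᵛ (symmetrise G)
  symmetrise-symmetric u v = Bool.∨-comm (hasArc u v) (hasArc v u)

  symmetrise-adjacent : ∀ {u v} → FinDigraph.Arc (symmetrise G) u v → Adjacentᵛ G u v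
  symmetrise-adjacent {u} {v} uv with hasArc u v in eq
  ... | true = inj₁ refl
  ... | false = inj₂ uv

  symmetrise-triangleFree : TriangleFreeᵛ G → TriangleFreeᵛ (symmetrise G)
  symmetrise-triangleFree tf u v w (uv , vw , uw) =
    tf u v w (adjacent uv , adjacent vw , adjacent uw)
    where
    adjacent : ∀ {u v} → Adjacentᵛ (symmetrise G) u v → Adjacentᵛ G u v
    adjacent (inj₁ uv) = symmetrise-adjacent uv
    adjacent (inj₂ vu) = Sum.swap (symmetrise-adjacent vu)

  symmetrise-noAcyclicColouring : ∀ {k} → NoAcyclicColouring G k → NoAcyclicColouring (symmetrise G) k
  symmetrise-noAcyclicColouring none col acyclic =
    none col (recolour inclusion (λ a → a) (λ _ → refl) acyclic)
    where
    inclusion : Embedding G (symmetrise G)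
    inclusion = record
      { embed = λ v → v ; injective = λ eq → eq ; arcs = λ {u} {v} uv → cong (_∨ hasArc v u) uv }

orientedTriangleFree-unbounded : Unbounded OrientedTriangleFree
orientedTriangleFree-unbounded = NoAcyclicColouring⇒Unbounded λ n →
  let open TriangleFreeOriented (triangleFreeOriented n) in
  graph , (Orientedᵛ⇒Oriented graph oriented , TriangleFreeᵛ⇒TriangleFree graph triangle-free) , no-colouring

symmetricTriangleFree-unbounded : Unbounded SymmetricTriangleFree
symmetricTriangleFree-unbounded = NoAcyclicColouring⇒Unbounded λ n →
  let open TriangleFreeOriented (triangleFreeOriented n) in
  symmetrise graph ,
  (Symmetricᵛ⇒Symmetric (symmetrise graph) (symmetrise-symmetric graph) ,
   TriangleFreeᵛ⇒TriangleFree (symmetrise graph) (symmetrise-triangleFree graph triangle-free)) ,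
  symmetrise-noAcyclicColouring graph no-colouring

heroic⇒digon-arcK₂-when-complete : ∀ F G → Heroic₂ F G → 2 ≤ size F → 2 ≤ size G → Complete F →
  F ≅ digon × G ≅ arcK₂
heroic⇒digon-arcK₂-when-complete F G h 2≤F 2≤G cF = heroic-with-complete F G 2≤F 2≤G cF
  (heroic-meets F G h ⊑-tournament tournament-unbounded Tournament?)
  (heroic-meets F G h (∩-hereditary ⊑-oriented ⊑-triangleFree) orientedTriangleFree-unbounded
    (Oriented? ∩? TriangleFree?))
  (heroic-meets F G h (∩-hereditary ⊑-symmetric ⊑-triangleFree) symmetricTriangleFree-unbounded
    (Symmetric? ∩? TriangleFree?))

theorem6 : ∀ (F₁ F₂ : Digraph) → 2 ≤ size F₁ → 2 ≤ size F₂ → ¬ (F₁ ≅ F₂) →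
    Heroic₂ F₁ F₂ ⇔ ((F₁ ≅ digon × F₂ ≅ arcK₂) ⊎ (F₁ ≅ arcK₂ × F₂ ≅ digon))
theorem6 F₁ F₂ 2≤F₁ 2≤F₂ _ = mk⇔ forward backward
  where
  forward : Heroic₂ F₁ F₂ → (F₁ ≅ digon × F₂ ≅ arcK₂) ⊎ (F₁ ≅ arcK₂ × F₂ ≅ digon)
  forward h with heroic-meets F₁ F₂ h ⊑-complete complete-unbounded Complete?
  ... | inj₁ c₁ = inj₁ (heroic⇒digon-arcK₂-when-complete F₁ F₂ h 2≤F₁ 2≤F₂ c₁)
  ... | inj₂ c₂ =
    inj₂ (Product.swap (heroic⇒digon-arcK₂-when-complete F₂ F₁ (heroic-swap F₁ F₂ h) 2≤F₂ 2≤F₁ c₂))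
  backward : (F₁ ≅ digon × F₂ ≅ arcK₂) ⊎ (F₁ ≅ arcK₂ × F₂ ≅ digon) → Heroic₂ F₁ F₂
  backward (inj₁ (F₁≅ , F₂≅)) = heroic-digon-arcK₂ F₁ F₂ F₁≅ F₂≅
  backward (inj₂ (F₁≅ , F₂≅)) = heroic-swap F₂ F₁ (heroic-digon-arcK₂ F₂ F₁ F₂≅ F₁≅)
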